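{- For all partitions $\lambda,\nu\vdash n$, we have $f^\nu\le \mathrm{B}(\lambda,\lambda',\nu)$.
   Context: $f^\nu$ is the number of standard Young tableaux of shape $\nu$ (the dimension of the irreducible $S_n$-representation indexed by $\nu$). $\lambda'$ is the conjugate partition. For $\alpha,\beta,\gamma\vdash n$, $\mathrm{B}(\alpha,\beta,\gamma)$ is the number of arrays $(x_{ijk})$ with entries in $\{0,1\}$, $1\le i\le\ell(\alpha)$, $1\le j\le\ell(\beta)$, $1\le k\le\ell(\gamma)$, with $\sum_{j,k}x_{ijk}=\alpha_i$, $\sum_{i,k}x_{ijk}=\beta_j$, $\sum_{i,j}x_{ijk}=\gamma_k$ for all $i,j,k$; $\ell(\cdot)$ is number of parts. -}

module Defs where

open import Data.Bool using (Bool; true; false; _∧_; _∨_; if_then_else_; T?)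
open import Data.Nat using (ℕ; zero; suc; _+_; _≤_; _<_; _⊔_; _≡ᵇ_; _<ᵇ_; _≤ᵇ_)
open import Data.Nat.Properties using ()
open import Data.List using (List; []; _∷_; map; concat; concatMap; length; upTo; filter; foldr; zipWith; zip; replicate)
open import Data.Nat.ListAction using (sum)
open import Data.Bool.ListAction using (all)
open import Data.List.Relation.Unary.All using (All)
open import Data.List.Relation.Unary.Linked using (Linked)
open import Data.Product using (_×_; _,_)
open import Relation.Binary.PropositionalEquality using (_≡_)

-- ## Partitions
-- A partition of n is a weakly decreasing list of positive naturals summing to n.
-- Parts are indexed from 0 in the list (part i+1 of the paper is the i-th entry).
IsPartition : ℕ → List ℕ → Set
IsPartition n λ′ = Linked (λ a b → b ≤ a) λ′ × All (λ a → 0 < a) λ′ × sum λ′ ≡ n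

ℓ : List ℕ → ℕ
ℓ = length

maxPart : List ℕ → ℕ
maxPart = foldr _⊔_ 0

-- conjugate partition: λ'_j = #{ i : λ_i ≥ j } for j = 1 .. λ_1
conj : List ℕ → List ℕ
conj λ′ = map (λ j → length (filter (λ a → T? (suc j ≤ᵇ a)) λ′)) (upTo (maxPart λ′))

listsOf : {A : Set} → List A → ℕ → List (List A)
listsOf xs zero    = [] ∷ []
listsOf xs (suc k) = concatMap (λ x → map (x ∷_) (listsOf xs k)) xs

count : {A : Set} → (A → Bool) → List A → ℕ
count p xs = length (filter (λ x → T? (p x)) xs)

eqL : List ℕ → List ℕ → Bool
eqL []       []       = true
eqL (x ∷ xs) (y ∷ ys) = (x ≡ᵇ y) ∧ eqL xs ys
eqL _        _        = false

-- ## Standard Young tableaux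
-- cells of the Young diagram of ν, as (row , column), 0-indexed, in row-reading order
cells : List ℕ → List (ℕ × ℕ)
cells ν = concat (zipWith (λ i r → map (λ j → (i , j)) (upTo r)) (upTo (length ν)) ν)

distinct : List ℕ → Bool
distinct []       = true
distinct (x ∷ xs) = all (λ y → not′ (x ≡ᵇ y)) xs ∧ distinct xs
  where
  not′ : Bool → Bool
  not′ true  = false
  not′ false = true

increasing : List ((ℕ × ℕ) × ℕ) → Bool
increasing f = all (λ { ((i , j) , a) → all (λ { ((i′ , j′) , b) →
                 if ((i ≡ᵇ i′) ∧ (suc j ≡ᵇ j′)) ∨ ((suc i ≡ᵇ i′) ∧ (j ≡ᵇ j′))
                 then a <ᵇ b else true }) f }) f

-- A standard Young tableau of shape ν ⊢ n: a filling of the n cells (in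
-- row-reading order) by values in {1..n}, each used exactly once (distinct +
-- n values from an n-element set), increasing along rows and columns.
-- f^ν = number of such fillings.
fSYT : List ℕ → ℕ
fSYT ν = count (λ vs → distinct vs ∧ increasing (zip (cells ν) vs))
               (listsOf (map suc (upTo (sum ν))) (sum ν))

-- ## The count B(α, β, γ)
-- 0/1 arrays x_{ijk}, i < ℓ(α), j < ℓ(β), k < ℓ(γ), stored as nested lists x[i][j][k]
b2n : Bool → ℕ
b2n true  = 1
b2n false = 0

addV : List ℕ → List ℕ → List ℕ
addV = zipWith _+_

-- margins: Σ_{j,k} x_ijk (indexed by i), Σ_{i,k} x_ijk (by j), Σ_{i,j} x_ijk (by k)
margin1 : List (List (List Bool)) → List ℕ
margin1 x = map (λ slab → sum (map (λ row → sum (map b2n row)) slab)) x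

margin2 : ℕ → List (List (List Bool)) → List ℕ
margin2 b x = foldr addV (replicate b 0) (map (map (λ row → sum (map b2n row))) x)

margin3 : ℕ → List (List (List Bool)) → List ℕ
margin3 c x = foldr addV (replicate c 0)
                (map (λ slab → foldr addV (replicate c 0) (map (map b2n) slab)) x)

B : List ℕ → List ℕ → List ℕ → ℕ
B α β γ = count (λ x → eqL (margin1 x) α ∧ eqL (margin2 (ℓ β) x) β ∧ eqL (margin3 (ℓ γ) x) γ)
                (listsOf (listsOf (listsOf (false ∷ true ∷ []) (ℓ γ)) (ℓ β)) (ℓ α))

-- f^ν ≤ B(λ, λ′, ν) for partitions λ, ν ⊢ n, by an explicit injection from
-- standard Young tableaux of shape ν into 0/1 arrays with margins (λ, λ′, ν).
-- A tableau is encoded by its row word w (w t = the row containing t + 1).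
-- Numbering the cells of λ by 0, …, n − 1 in row-reading order, the cell t in
-- row i, column j receives the one-hot vector at w t in the third direction,
-- and positions (i, j) outside λ receive 0.  Then margin 1 is λ, margin 2 is
-- j ↦ #{ i : j < λ_i } = λ′_j, and margin 3 counts the t with w t = k, i.e.
-- the length ν_k of row k.  As rows of a tableau increase, the tableau is
-- determined by its row word, which in turn is read off the array.
module Submission where

open import Data.Bool using (Bool; true; false; _∧_; _∨_; if_then_else_; T; T?)
open import Data.Bool.Properties using (T-∧; T-≡)
open import Data.Bool.ListAction using (all)
open import Data.Nat
open import Data.Nat.Properties
open import Data.Nat.ListAction using (sum)
open import Data.List using (List; []; _∷_; map; concat; length; upTo; filter; foldr; zipWith; zip; replicate; applyUpTo; _++_; take; drop)
open import Data.List.Properties using (map-applyUpTo; length-map; length-++; length-applyUpTo; length-take; length-drop; take++drop≡id; ∷-injectiveˡ; ∷-injectiveʳ)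
open import Data.List.Relation.Unary.All as All using (All; []; _∷_)
open import Data.List.Relation.Unary.All.Properties as AllP using ()
open import Data.List.Relation.Unary.Any using (here; there)
open import Data.List.Relation.Unary.AllPairs as AllPairs using ([]; _∷_)
open import Data.List.Relation.Unary.AllPairs.Properties as AllPairsP using ()
open import Data.List.Relation.Unary.Linked as Linked using (Linked; []; [-]; _∷_)
open import Data.List.Relation.Unary.Linked.Properties using (Linked⇒AllPairs)
open import Data.List.Relation.Unary.Unique.Propositional using (Unique)
open import Data.List.Relation.Unary.Unique.Propositional.Properties as UniqueP using ()
open import Data.List.Relation.Binary.Disjoint.Propositional using (Disjoint)
open import Data.List.Membership.Propositional using (_∈_; _∉_)
open import Data.List.Membership.Propositional.Properties
open import Data.List.Membership.DecPropositional _≟_ using (_∈?_)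
open import Data.Product using (_×_; _,_; proj₁; proj₂; uncurry)
open import Data.Sum using (inj₁; inj₂)
open import Data.Empty using (⊥-elim)
open import Function using (_∘_; Equivalence)
open import Relation.Nullary using (yes; no; does)
open import Relation.Nullary.Decidable using (dec-false)
open import Relation.Binary.PropositionalEquality
open import Algebra.Properties.CommutativeSemigroup +-commutativeSemigroup using () renaming (interchange to +-interchange)
open import Defs

-- Counting by an injection

unique-⊆⇒length-≤ : {A : Set} {xs ys : List A} → Unique xs → (∀ {v} → v ∈ xs → v ∈ ys) →
                    length xs ≤ length ys
unique-⊆⇒length-≤ {xs = []} _ _ = z≤n
unique-⊆⇒length-≤ {xs = x ∷ xs} {ys} (x∉xs ∷ u) xs⊆ys with ∈-∃++ (xs⊆ys (here refl))
... | us , vs , refl = begin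
    suc (length xs)           ≤⟨ s≤s (unique-⊆⇒length-≤ u xs⊆us++vs) ⟩
    suc (length (us ++ vs))   ≡⟨ cong suc (length-++ us) ⟩
    suc (length us + length vs) ≡⟨ +-suc (length us) (length vs) ⟨
    length us + length (x ∷ vs) ≡⟨ length-++ us ⟨
    length (us ++ x ∷ vs)     ∎
  where
  open ≤-Reasoning
  xs⊆us++vs : ∀ {v} → v ∈ xs → v ∈ us ++ vs
  xs⊆us++vs v∈xs with ∈-++⁻ us (xs⊆ys (there v∈xs))
  ... | inj₁ v∈us         = ∈-++⁺ˡ v∈us
  ... | inj₂ (here refl)  = ⊥-elim (All.lookup x∉xs v∈xs refl)
  ... | inj₂ (there v∈vs) = ∈-++⁺ʳ us v∈vs

map-unique : {A C : Set} (f : A → C) {xs : List A} →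
             (∀ {x y} → x ∈ xs → y ∈ xs → f x ≡ f y → x ≡ y) → Unique xs → Unique (map f xs)
map-unique f {[]} _ [] = []
map-unique f {x ∷ xs} inj (x∉xs ∷ u) =
  AllP.map⁺ (All.tabulate fx≢) ∷ map-unique f (λ p q → inj (there p) (there q)) u
  where
  fx≢ : ∀ {y} → y ∈ xs → f x ≢ f y
  fx≢ y∈xs e = All.lookup x∉xs y∈xs (inj (here refl) (there y∈xs) e)

count-≤-by-injection : {A C : Set} (p : A → Bool) (q : C → Bool) (xs : List A) (ys : List C) (f : A → C) →
  Unique xs →
  (∀ {x} → x ∈ xs → T (p x) → f x ∈ ys × T (q (f x))) →
  (∀ {x y} → x ∈ xs → y ∈ xs → T (p x) → T (p y) → f x ≡ f y → x ≡ y) →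
  count p xs ≤ count q ys
count-≤-by-injection {A} p q xs ys f u maps inj = begin
    count p xs         ≡⟨ length-map f P ⟨
    length (map f P)   ≤⟨ unique-⊆⇒length-≤ (map-unique f inj-P (UniqueP.filter⁺ (T? ∘ p) u)) image ⟩
    count q ys         ∎
  where
  open ≤-Reasoning
  P : List A
  P = filter (T? ∘ p) xs
  inj-P : ∀ {x y} → x ∈ P → y ∈ P → f x ≡ f y → x ≡ y
  inj-P x∈ y∈ with ∈-filter⁻ (T? ∘ p) x∈ | ∈-filter⁻ (T? ∘ p) y∈
  ... | x∈xs , px | y∈xs , py = inj x∈xs y∈xs px py
  image : ∀ {v} → v ∈ map f P → v ∈ filter (T? ∘ q) ys
  image v∈ with ∈-map⁻ f v∈
  ... | x , x∈P , refl with ∈-filter⁻ (T? ∘ p) x∈P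
  ... | x∈xs , px = uncurry (∈-filter⁺ (T? ∘ q)) (maps x∈xs px)

∈-listsOf⁻ : {A : Set} (xs : List A) (k : ℕ) {ys : List A} → ys ∈ listsOf xs k →
             length ys ≡ k × All (_∈ xs) ys
∈-listsOf⁻ xs zero (here refl) = refl , []
∈-listsOf⁻ xs (suc k) ys∈ with ∈-concat⁻′ (map (λ x → map (x ∷_) (listsOf xs k)) xs) ys∈
... | zs , ys∈zs , zs∈ with ∈-map⁻ (λ x → map (x ∷_) (listsOf xs k)) zs∈
... | x , x∈xs , refl with ∈-map⁻ (x ∷_) ys∈zs
... | ys′ , ys′∈ , refl with ∈-listsOf⁻ xs k ys′∈
... | len , entries = cong suc len , x∈xs ∷ entries

∈-listsOf⁺ : {A : Set} (xs : List A) {k : ℕ} {ys : List A} → length ys ≡ k → All (_∈ xs) ys →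
             ys ∈ listsOf xs k
∈-listsOf⁺ xs refl [] = here refl
∈-listsOf⁺ xs {ys = y ∷ ys} refl (y∈xs ∷ entries) =
  ∈-concat⁺′ (∈-map⁺ (y ∷_) (∈-listsOf⁺ xs refl entries))
             (∈-map⁺ (λ x → map (x ∷_) (listsOf xs (length ys))) y∈xs)

-- listsOf of a duplicate-free alphabet has no repetitions: lists with
-- different heads are different, and so are lists with different tails.
listsOf-unique : {A : Set} (xs : List A) (k : ℕ) → Unique xs → Unique (listsOf xs k)
listsOf-unique xs zero    _ = [] ∷ []
listsOf-unique xs (suc k) u =
  UniqueP.concat⁺ (AllP.map⁺ (All.tabulate (λ _ → UniqueP.map⁺ ∷-injectiveʳ (listsOf-unique xs k u))))
                  (AllPairsP.map⁺ (AllPairs.map extensions-disjoint u))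
  where
  extensions-disjoint : ∀ {x y} → x ≢ y → Disjoint (map (x ∷_) (listsOf xs k)) (map (y ∷_) (listsOf xs k))
  extensions-disjoint x≢y (p , q) with ∈-map⁻ (_ ∷_) p | ∈-map⁻ (_ ∷_) q
  ... | _ , _ , refl | _ , _ , e = x≢y (∷-injectiveˡ e)

-- Equational forms of the reflection lemmas for ≡ᵇ and <ᵇ, as needed to
-- evaluate the if-then-else and ∧ of the definitions.
≡ᵇ-refl : ∀ n → (n ≡ᵇ n) ≡ true
≡ᵇ-refl n = Equivalence.to T-≡ (≡⇒≡ᵇ n n refl)

<⇒<ᵇ≡true : ∀ {j a} → j < a → (j <ᵇ a) ≡ true
<⇒<ᵇ≡true = Equivalence.to T-≡ ∘ <⇒<ᵇ

≥⇒<ᵇ≡false : ∀ {j a} → a ≤ j → (j <ᵇ a) ≡ false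
≥⇒<ᵇ≡false {j}     {zero}  _         = refl
≥⇒<ᵇ≡false {suc j} {suc a} (s≤s a≤j) = ≥⇒<ᵇ≡false a≤j

<ᵇ≡true⇒< : ∀ j a → (j <ᵇ a) ≡ true → j < a
<ᵇ≡true⇒< j a = <ᵇ⇒< j a ∘ Equivalence.from T-≡

all-sound : {A : Set} (p : A → Bool) {xs : List A} → T (all p xs) → ∀ {x} → x ∈ xs → T (p x)
all-sound p h (here refl) = proj₁ (Equivalence.to T-∧ h)
all-sound p h (there x∈)  = all-sound p (proj₂ (Equivalence.to T-∧ h)) x∈

eqL-refl : ∀ xs → T (eqL xs xs)
eqL-refl []       = _
eqL-refl (x ∷ xs) = Equivalence.from T-∧ (≡⇒≡ᵇ x x refl , eqL-refl xs)

margins-test : ∀ {a b c α β γ} → a ≡ α → b ≡ β → c ≡ γ → T (eqL a α ∧ eqL b β ∧ eqL c γ)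
margins-test {α = α} {β} {γ} refl refl refl =
  Equivalence.from T-∧ (eqL-refl α , Equivalence.from T-∧ (eqL-refl β , eqL-refl γ))

distinct⇒unique : ∀ xs → T (distinct xs) → Unique xs
distinct⇒unique []       _ = []
distinct⇒unique (x ∷ xs) h with Equivalence.to T-∧ h
... | fresh , rest = All.tabulate x≢ ∷ distinct⇒unique xs rest
  where
  x≢ : ∀ {y} → y ∈ xs → x ≢ y
  x≢ y∈xs refl with all-sound _ fresh y∈xs
  ... | x≠x rewrite ≡ᵇ-refl x = x≠x

-- The only consequence of `increasing` we need: along a row, entries increase.
RowIncreasing : List ((ℕ × ℕ) × ℕ) → Set
RowIncreasing Z = ∀ {i j a b} → ((i , j) , a) ∈ Z → ((i , suc j) , b) ∈ Z → a < b

increasing⇒row-increasing : ∀ Z → T (increasing Z) → RowIncreasing Z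
increasing⇒row-increasing Z h {i} {j} {a} {b} p q with all-sound _ (all-sound _ h p) q
... | a<ᵇb rewrite ≡ᵇ-refl i | ≡ᵇ-refl j = <ᵇ⇒< a b a<ᵇb

∑< : ℕ → (ℕ → ℕ) → ℕ
∑< n f = sum (applyUpTo f n)

applyUpTo-cong : {A : Set} (f g : ℕ → A) (n : ℕ) → (∀ t → t < n → f t ≡ g t) → applyUpTo f n ≡ applyUpTo g n
applyUpTo-cong f g zero    _ = refl
applyUpTo-cong f g (suc n) h =
  cong₂ _∷_ (h 0 z<s) (applyUpTo-cong (f ∘ suc) (g ∘ suc) n (λ t t<n → h (suc t) (s<s t<n)))

∑<-cong : (n : ℕ) {f g : ℕ → ℕ} → (∀ t → t < n → f t ≡ g t) → ∑< n f ≡ ∑< n g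
∑<-cong n {f} {g} h = cong sum (applyUpTo-cong f g n h)

∑<-zero : (n : ℕ) → ∑< n (λ _ → 0) ≡ 0
∑<-zero zero    = refl
∑<-zero (suc n) = ∑<-zero n

∑<-one : (n : ℕ) → ∑< n (λ _ → 1) ≡ n
∑<-one zero    = refl
∑<-one (suc n) = cong suc (∑<-one n)

∑<-split : (a b : ℕ) (f : ℕ → ℕ) → ∑< (a + b) f ≡ ∑< a f + ∑< b (λ t → f (a + t))
∑<-split zero    b f = refl
∑<-split (suc a) b f = trans (cong (f 0 +_) (∑<-split a b (f ∘ suc))) (sym (+-assoc (f 0) _ _))

∑<-+ : (n : ℕ) (f g : ℕ → ℕ) → ∑< n (λ t → f t + g t) ≡ ∑< n f + ∑< n g
∑<-+ zero    f g = refl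
∑<-+ (suc n) f g = begin
    f 0 + g 0 + ∑< n (λ t → f (suc t) + g (suc t)) ≡⟨ cong (f 0 + g 0 +_) (∑<-+ n (f ∘ suc) (g ∘ suc)) ⟩
    f 0 + g 0 + (∑< n (f ∘ suc) + ∑< n (g ∘ suc))   ≡⟨ +-interchange (f 0) (g 0) _ _ ⟩
    f 0 + ∑< n (f ∘ suc) + (g 0 + ∑< n (g ∘ suc))   ∎
  where open ≡-Reasoning

∑<-truncate : (a b : ℕ) (f : ℕ → ℕ) → a ≤ b → ∑< b (λ j → if j <ᵇ a then f j else 0) ≡ ∑< a f
∑<-truncate a b f a≤b with m≤n⇒∃[o]m+o≡n a≤b
... | d , refl = begin
    ∑< (a + d) g                        ≡⟨ ∑<-split a d g ⟩
    ∑< a g + ∑< d (λ t → g (a + t))     ≡⟨ cong₂ _+_ (∑<-cong a below) (∑<-cong d above) ⟩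
    ∑< a f + ∑< d (λ _ → 0)             ≡⟨ cong (∑< a f +_) (∑<-zero d) ⟩
    ∑< a f + 0                          ≡⟨ +-identityʳ _ ⟩
    ∑< a f                              ∎
  where
  open ≡-Reasoning
  g : ℕ → ℕ
  g j = if j <ᵇ a then f j else 0
  below : ∀ t → t < a → g t ≡ f t
  below t t<a = cong (λ c → if c then f t else 0) (<⇒<ᵇ≡true t<a)
  above : ∀ t → t < d → g (a + t) ≡ 0
  above t _ = cong (λ c → if c then f (a + t) else 0) (≥⇒<ᵇ≡false (m≤m+n a t))

∑<-≤ : (n : ℕ) (f : ℕ → ℕ) → (∀ t → f t ≤ 1) → ∑< n f ≤ n
∑<-≤ zero    f _ = z≤n
∑<-≤ (suc n) f h = +-mono-≤ (h 0) (∑<-≤ n (f ∘ suc) (h ∘ suc))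

∑<-saturated : (n : ℕ) (f : ℕ → ℕ) → (∀ t → f t ≤ 1) → ∑< n f ≡ n → ∀ t → t < n → f t ≡ 1
∑<-saturated (suc n) f h e t t<n with f 0 in f0 | h 0
... | 0 | _ = ⊥-elim (<-irrefl refl (≤-trans (≤-reflexive (sym e)) (∑<-≤ n (f ∘ suc) (h ∘ suc))))
... | 1 | _ with t
...   | zero   = f0
...   | suc t′ = ∑<-saturated n (f ∘ suc) (h ∘ suc) (suc-injective e) t′ (≤-pred t<n)
∑<-saturated (suc n) f h e t t<n | suc (suc _) | s≤s ()

δ : ℕ → ℕ → ℕ
δ m k = b2n (m ≡ᵇ k)

δ-refl : ∀ m → δ m m ≡ 1
δ-refl m rewrite ≡ᵇ-refl m = refl

∑<-δ : (L k : ℕ) → k < L → ∑< L (λ m → δ m k) ≡ 1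
∑<-δ (suc L) zero    _         = cong suc (∑<-zero L)
∑<-δ (suc L) (suc k) (s≤s k<L) = ∑<-δ L k k<L

addV-applyUpTo : (L : ℕ) (f g : ℕ → ℕ) → addV (applyUpTo f L) (applyUpTo g L) ≡ applyUpTo (λ m → f m + g m) L
addV-applyUpTo zero    f g = refl
addV-applyUpTo (suc L) f g = cong (f 0 + g 0 ∷_) (addV-applyUpTo L (f ∘ suc) (g ∘ suc))

replicate-applyUpTo : (L : ℕ) → replicate L 0 ≡ applyUpTo (λ _ → 0) L
replicate-applyUpTo zero    = refl
replicate-applyUpTo (suc L) = cong (0 ∷_) (replicate-applyUpTo L)

foldr-addV-applyUpTo : (L b : ℕ) (H : ℕ → ℕ → ℕ) →
  foldr addV (replicate L 0) (applyUpTo (λ j → applyUpTo (H j) L) b) ≡ applyUpTo (λ m → ∑< b (λ j → H j m)) L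
foldr-addV-applyUpTo L zero    H = replicate-applyUpTo L
foldr-addV-applyUpTo L (suc b) H =
  trans (cong (addV (applyUpTo (H 0) L)) (foldr-addV-applyUpTo L b (H ∘ suc))) (addV-applyUpTo L (H 0) _)

nth : {A : Set} → A → List A → ℕ → A
nth d []       _       = d
nth d (x ∷ xs) zero    = x
nth d (x ∷ xs) (suc m) = nth d xs m

nth-applyUpTo : {A : Set} (d : A) (f : ℕ → A) (b t : ℕ) → t < b → nth d (applyUpTo f b) t ≡ f t
nth-applyUpTo d f (suc b) zero    _         = refl
nth-applyUpTo d f (suc b) (suc t) (s≤s t<b) = nth-applyUpTo d (f ∘ suc) b t t<b

applyUpTo-nth : (ν : List ℕ) (h : ℕ → ℕ) → (∀ m → m < length ν → h m ≡ nth 0 ν m) → applyUpTo h (length ν) ≡ ν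
applyUpTo-nth []      h _ = refl
applyUpTo-nth (x ∷ ν) h e = cong₂ _∷_ (e 0 z<s) (applyUpTo-nth ν (h ∘ suc) (λ m m<ℓ → e (suc m) (s<s m<ℓ)))

nth-ext : {A : Set} (d : A) (cs ds : List A) → length cs ≡ length ds →
          (∀ m → m < length cs → nth d cs m ≡ nth d ds m) → cs ≡ ds
nth-ext d []       []       _ _ = refl
nth-ext d (c ∷ cs) (x ∷ ds) l h =
  cong₂ _∷_ (h 0 z<s) (nth-ext d cs ds (suc-injective l) (λ m m<ℓ → h (suc m) (s<s m<ℓ)))

All-nth : {A : Set} {P : A → Set} (d : A) (xs : List A) → All P xs → ∀ m → m < length xs → P (nth d xs m)
All-nth d (x ∷ xs) (px ∷ _)   zero    _         = px
All-nth d (x ∷ xs) (_  ∷ pxs) (suc m) (s≤s m<ℓ) = All-nth d xs pxs m m<ℓ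

-- The 0/1 array of a word

Bounded : (ℕ → ℕ) → ℕ → ℕ → Set
Bounded w n L = ∀ t → t < n → w t < L

bounded-head : ∀ {L a as} (w : ℕ → ℕ) → Bounded w (sum (a ∷ as)) L → Bounded w a L
bounded-head {a = a} {as} w bd t t<a = bd t (<-≤-trans t<a (m≤m+n a (sum as)))

bounded-tail : ∀ {L a as} (w : ℕ → ℕ) → Bounded w (sum (a ∷ as)) L → Bounded (λ t → w (a + t)) (sum as) L
bounded-tail {a = a} w bd t t<s = bd (a + t) (+-monoʳ-< a t<s)

onehot : ℕ → ℕ → List Bool
onehot L k = applyUpTo (λ m → m ≡ᵇ k) L

onehot-injective : (L k k′ : ℕ) → k < L → onehot L k ≡ onehot L k′ → k ≡ k′
onehot-injective L k k′ k<L e = ≡ᵇ⇒≡ k k′ (Equivalence.from T-≡ (sym k≡ᵇk′))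
  where
  k≡ᵇk′ : true ≡ (k ≡ᵇ k′)
  k≡ᵇk′ = begin
    true                         ≡⟨ ≡ᵇ-refl k ⟨
    k ≡ᵇ k                       ≡⟨ nth-applyUpTo false (_≡ᵇ k) L k k<L ⟨
    nth false (onehot L k) k     ≡⟨ cong (λ v → nth false v k) e ⟩
    nth false (onehot L k′) k    ≡⟨ nth-applyUpTo false (_≡ᵇ k′) L k k<L ⟩
    k ≡ᵇ k′                      ∎
    where open ≡-Reasoning

-- The fibre (x_{i j k})_{k < L} in column j of a row of λ of length a, where w
-- has been shifted so that the first cell of the row has index 0: a one-hot
-- vector at w j inside the row, zero outside.
fibre : ℕ → ℕ → (ℕ → ℕ) → ℕ → List Bool
fibre L a w j = if j <ᵇ a then onehot L (w j) else applyUpTo (λ _ → false) L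

wordArray : ℕ → ℕ → List ℕ → (ℕ → ℕ) → List (List (List Bool))
wordArray L b []       w = []
wordArray L b (a ∷ as) w = applyUpTo (fibre L a w) b ∷ wordArray L b as (λ t → w (a + t))

weight : List Bool → ℕ
weight v = sum (map b2n v)

fibre-weight : (L a : ℕ) (w : ℕ → ℕ) (j : ℕ) → (j < a → w j < L) → weight (fibre L a w j) ≡ b2n (j <ᵇ a)
fibre-weight L a w j bound with j <ᵇ a in j<ᵇa
... | true  = trans (cong sum (map-applyUpTo _ b2n L)) (∑<-δ L (w j) (bound (<ᵇ≡true⇒< j a j<ᵇa)))
... | false = trans (cong sum (map-applyUpTo _ b2n L)) (∑<-zero L)

fibre-layers : (L a : ℕ) (w : ℕ → ℕ) (j : ℕ) → map b2n (fibre L a w j) ≡ applyUpTo (λ m → if j <ᵇ a then δ m (w j) else 0) L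
fibre-layers L a w j with j <ᵇ a
... | true  = map-applyUpTo _ b2n L
... | false = map-applyUpTo _ b2n L

b2n-if : ∀ (c : Bool) → b2n c ≡ (if c then 1 else 0)
b2n-if true  = refl
b2n-if false = refl

row-weight : (L b a : ℕ) (w : ℕ → ℕ) → a ≤ b → Bounded w a L →
             sum (map weight (applyUpTo (fibre L a w) b)) ≡ a
row-weight L b a w a≤b bd = begin
  sum (map weight (applyUpTo (fibre L a w) b))   ≡⟨ cong sum (map-applyUpTo _ weight b) ⟩
  ∑< b (weight ∘ fibre L a w)                    ≡⟨ ∑<-cong b (λ j _ → trans (fibre-weight L a w j (bd j)) (b2n-if (j <ᵇ a))) ⟩
  ∑< b (λ j → if j <ᵇ a then 1 else 0)           ≡⟨ ∑<-truncate a b (λ _ → 1) a≤b ⟩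
  ∑< a (λ _ → 1)                                 ≡⟨ ∑<-one a ⟩
  a                                              ∎
  where open ≡-Reasoning

margin1-wordArray : (L b : ℕ) (λs : List ℕ) (w : ℕ → ℕ) → All (_≤ b) λs → Bounded w (sum λs) L →
                    margin1 (wordArray L b λs w) ≡ λs
margin1-wordArray L b []       w _           _  = refl
margin1-wordArray L b (a ∷ as) w (a≤b ∷ as≤b) bd =
  cong₂ _∷_ (row-weight L b a w a≤b (bounded-head {as = as} w bd))
            (margin1-wordArray L b as (λ t → w (a + t)) as≤b (bounded-tail {as = as} w bd))

margin2-wordArray : (L b : ℕ) (λs : List ℕ) (w : ℕ → ℕ) → Bounded w (sum λs) L →
                    margin2 b (wordArray L b λs w) ≡ applyUpTo (λ j → sum (map (λ a → b2n (j <ᵇ a)) λs)) b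
margin2-wordArray L b []       w _  = replicate-applyUpTo b
margin2-wordArray L b (a ∷ as) w bd = trans
  (cong₂ addV (trans (map-applyUpTo _ weight b)
                     (applyUpTo-cong _ _ b (λ j _ → fibre-weight L a w j (bounded-head {as = as} w bd j))))
              (margin2-wordArray L b as (λ t → w (a + t)) (bounded-tail {as = as} w bd)))
  (addV-applyUpTo b _ _)

margin3-wordArray : (L b : ℕ) (λs : List ℕ) (w : ℕ → ℕ) → All (_≤ b) λs →
                    margin3 L (wordArray L b λs w) ≡ applyUpTo (λ m → ∑< (sum λs) (λ t → δ m (w t))) L
margin3-wordArray L b []       w _            = replicate-applyUpTo L
margin3-wordArray L b (a ∷ as) w (a≤b ∷ as≤b) = begin
    addV (foldr addV (replicate L 0) (map (map b2n) (applyUpTo (fibre L a w) b))) (margin3 L (wordArray L b as w′))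
  ≡⟨ cong₂ addV row (margin3-wordArray L b as w′ as≤b) ⟩
    addV (applyUpTo (λ m → ∑< b (λ j → H j m)) L) (applyUpTo (λ m → ∑< (sum as) (λ t → δ m (w′ t))) L)
  ≡⟨ addV-applyUpTo L _ _ ⟩
    applyUpTo (λ m → ∑< b (λ j → H j m) + ∑< (sum as) (λ t → δ m (w′ t))) L
  ≡⟨ applyUpTo-cong _ _ L (λ m _ → trans (cong (_+ _) (∑<-truncate a b (λ j → δ m (w j)) a≤b))
                                          (sym (∑<-split a (sum as) (λ t → δ m (w t))))) ⟩
    applyUpTo (λ m → ∑< (a + sum as) (λ t → δ m (w t))) L
  ∎
  where
  open ≡-Reasoning
  w′ : ℕ → ℕ
  w′ t = w (a + t)
  H : ℕ → ℕ → ℕ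
  H j m = if j <ᵇ a then δ m (w j) else 0
  row : foldr addV (replicate L 0) (map (map b2n) (applyUpTo (fibre L a w) b)) ≡ applyUpTo (λ m → ∑< b (λ j → H j m)) L
  row = trans (cong (foldr addV (replicate L 0)) (trans (map-applyUpTo _ (map b2n) b)
                                                        (applyUpTo-cong _ _ b (λ j _ → fibre-layers L a w j))))
              (foldr-addV-applyUpTo L b H)

cellFibre : List (List (List Bool)) → List ℕ → ℕ → List Bool
cellFibre (s ∷ x) (a ∷ as) t = if t <ᵇ a then nth [] s t else cellFibre x as (t ∸ a)
cellFibre _       _        _ = []

cellFibre-wordArray : (L b : ℕ) (λs : List ℕ) (w : ℕ → ℕ) → All (_≤ b) λs →
                      ∀ t → t < sum λs → cellFibre (wordArray L b λs w) λs t ≡ onehot L (w t)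
cellFibre-wordArray L b (a ∷ as) w (a≤b ∷ as≤b) t t<s with t <ᵇ a in t<ᵇa
... | true  = trans (nth-applyUpTo [] (fibre L a w) b t (<-≤-trans t<a a≤b))
                    (cong (λ c → if c then onehot L (w t) else applyUpTo (λ _ → false) L) t<ᵇa)
  where
  t<a : t < a
  t<a = <ᵇ≡true⇒< t a t<ᵇa
... | false = trans (cellFibre-wordArray L b as (λ u → w (a + u)) as≤b (t ∸ a) t∸a<)
                    (cong (onehot L ∘ w) (m+[n∸m]≡n a≤t))
  where
  a≤t : a ≤ t
  a≤t = ≮⇒≥ (λ t<a → true≢false (trans (sym (<⇒<ᵇ≡true t<a)) t<ᵇa))
    where
    true≢false : true ≢ false
    true≢false ()
  t∸a< : t ∸ a < sum as
  t∸a< = +-cancelˡ-< a (t ∸ a) (sum as) (subst (_< a + sum as) (sym (m+[n∸m]≡n a≤t)) t<s)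

All-applyUpTo : {A : Set} (P : A → Set) (f : ℕ → A) (b : ℕ) → (∀ j → j < b → P (f j)) → All P (applyUpTo f b)
All-applyUpTo P f zero    _ = []
All-applyUpTo P f (suc b) h = h 0 z<s ∷ All-applyUpTo P (f ∘ suc) b (λ j j<b → h (suc j) (s<s j<b))

bool∈ : (c : Bool) → c ∈ false ∷ true ∷ []
bool∈ false = here refl
bool∈ true  = there (here refl)

boolVector∈ : (L : ℕ) (f : ℕ → Bool) → applyUpTo f L ∈ listsOf (false ∷ true ∷ []) L
boolVector∈ L f = ∈-listsOf⁺ _ (length-applyUpTo f L) (All-applyUpTo _ f L (λ m _ → bool∈ (f m)))

fibre∈ : (L a : ℕ) (w : ℕ → ℕ) (j : ℕ) → fibre L a w j ∈ listsOf (false ∷ true ∷ []) L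
fibre∈ L a w j with j <ᵇ a
... | true  = boolVector∈ L (_≡ᵇ w j)
... | false = boolVector∈ L (λ _ → false)

wordArray∈ : (L b : ℕ) (λs : List ℕ) (w : ℕ → ℕ) →
             wordArray L b λs w ∈ listsOf (listsOf (listsOf (false ∷ true ∷ []) L) b) (length λs)
wordArray∈ L b λs w = ∈-listsOf⁺ _ (shape λs w) (rows∈ λs w)
  where
  shape : (λs : List ℕ) (w : ℕ → ℕ) → length (wordArray L b λs w) ≡ length λs
  shape []       w = refl
  shape (a ∷ as) w = cong suc (shape as (λ t → w (a + t)))
  rows∈ : (λs : List ℕ) (w : ℕ → ℕ) → All (_∈ listsOf (listsOf (false ∷ true ∷ []) L) b) (wordArray L b λs w)
  rows∈ []       w = []
  rows∈ (a ∷ as) w =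
    ∈-listsOf⁺ _ (length-applyUpTo _ b) (All-applyUpTo _ _ b (λ j _ → fibre∈ L a w j)) ∷ rows∈ as (λ t → w (a + t))

-- The conjugate partition

length-filter : (p : ℕ → Bool) (xs : List ℕ) → length (filter (T? ∘ p) xs) ≡ sum (map (b2n ∘ p) xs)
length-filter p []       = refl
length-filter p (x ∷ xs) with p x
... | true  = cong suc (length-filter p xs)
... | false = length-filter p xs

conj-applyUpTo : (λs : List ℕ) → conj λs ≡ applyUpTo (λ j → sum (map (λ a → b2n (j <ᵇ a)) λs)) (maxPart λs)
conj-applyUpTo λs = trans (map-applyUpTo _ _ (maxPart λs))
                          (applyUpTo-cong _ _ (maxPart λs) (λ j _ → length-filter (λ a → suc j ≤ᵇ a) λs))

length-conj : (λs : List ℕ) → length (conj λs) ≡ maxPart λs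
length-conj λs = trans (length-map _ (upTo (maxPart λs))) (length-applyUpTo _ (maxPart λs))

parts≤length-conj : (λs : List ℕ) → All (_≤ length (conj λs)) λs
parts≤length-conj λs = subst (λ k → All (_≤ k) λs) (sym (length-conj λs)) (parts≤maxPart λs)
  where
  parts≤maxPart : (λs : List ℕ) → All (_≤ maxPart λs) λs
  parts≤maxPart []       = []
  parts≤maxPart (a ∷ as) = m≤m⊔n a (maxPart as) ∷ All.map (λ p → ≤-trans p (m≤n⊔m a (maxPart as))) (parts≤maxPart as)

margin2-conj : (L : ℕ) (λs : List ℕ) (w : ℕ → ℕ) → Bounded w (sum λs) L →
               margin2 (length (conj λs)) (wordArray L (length (conj λs)) λs w) ≡ conj λs
margin2-conj L λs w bd = begin
  margin2 b (wordArray L b λs w)                                ≡⟨ margin2-wordArray L b λs w bd ⟩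
  applyUpTo (λ j → sum (map (λ a → b2n (j <ᵇ a)) λs)) b         ≡⟨ cong (applyUpTo _) (length-conj λs) ⟩
  applyUpTo (λ j → sum (map (λ a → b2n (j <ᵇ a)) λs)) (maxPart λs) ≡⟨ conj-applyUpTo λs ⟨
  conj λs                                                       ∎
  where
  open ≡-Reasoning
  b : ℕ
  b = length (conj λs)

rows : List ℕ → List ℕ → List (List ℕ)
rows []      vs = []
rows (r ∷ ν) vs = take r vs ∷ rows ν (drop r vs)

length-rows : (ν vs : List ℕ) → length (rows ν vs) ≡ length ν
length-rows []      vs = refl
length-rows (r ∷ ν) vs = cong suc (length-rows ν (drop r vs))

length-drop-row : (r : ℕ) (ν vs : List ℕ) → length vs ≡ r + sum ν → length (drop r vs) ≡ sum ν
length-drop-row r ν vs e = trans (length-drop r vs) (trans (cong (_∸ r) e) (m+n∸m≡n r (sum ν)))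

length-take-row : (r : ℕ) (ν vs : List ℕ) → length vs ≡ r + sum ν → length (take r vs) ≡ r
length-take-row r ν vs e = trans (length-take r vs) (m≤n⇒m⊓n≡m (subst (r ≤_) (sym e) (m≤m+n r (sum ν))))

concat-rows : (ν vs : List ℕ) → length vs ≡ sum ν → concat (rows ν vs) ≡ vs
concat-rows []      []  _ = refl
concat-rows (r ∷ ν) vs e =
  trans (cong (take r vs ++_) (concat-rows ν (drop r vs) (length-drop-row r ν vs e))) (take++drop≡id r vs)

length-row : (ν vs : List ℕ) → length vs ≡ sum ν → ∀ m → m < length ν → length (nth [] (rows ν vs) m) ≡ nth 0 ν m
length-row (r ∷ ν) vs e zero    _         = length-take-row r ν vs e
length-row (r ∷ ν) vs e (suc m) (s≤s m<ℓ) = length-row ν (drop r vs) (length-drop-row r ν vs e) m m<ℓ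

linked-row : (i : ℕ) (h : ℕ → ℕ) → (∀ j → h (suc j) ≡ suc (h j)) → (c : List ℕ) (Z : List ((ℕ × ℕ) × ℕ)) →
             (∀ {p} → p ∈ zip (applyUpTo (λ j → (i , h j)) (length c)) c → p ∈ Z) → RowIncreasing Z → Linked _<_ c
linked-row i h h-suc []          Z _   _   = []
linked-row i h h-suc (x ∷ [])    Z _   _   = [-]
linked-row i h h-suc (x ∷ y ∷ c) Z sub inc =
  inc (sub (here refl)) (subst (λ k → ((i , k) , y) ∈ Z) (h-suc 0) (sub (there (here refl))))
  ∷ linked-row i (h ∘ suc) (h-suc ∘ suc) (y ∷ c) Z (sub ∘ there) inc

zip-++ : {A C : Set} (xs ys : List A) (vs : List C) → zip (xs ++ ys) vs ≡ zip xs (take (length xs) vs) ++ zip ys (drop (length xs) vs)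
zip-++ []       ys vs       = refl
zip-++ (x ∷ xs) [] []       = refl
zip-++ (x ∷ xs) (y ∷ ys) [] = refl
zip-++ (x ∷ xs) ys (v ∷ vs) = cong (_ ∷_) (zip-++ xs ys vs)

rowCells : (ℕ → ℕ) → List ℕ → List (List (ℕ × ℕ))
rowCells g []      = []
rowCells g (r ∷ ν) = map (g 0 ,_) (upTo r) ∷ rowCells (g ∘ suc) ν

cells-rowCells : (g : ℕ → ℕ) (ν : List ℕ) →
                 zipWith (λ i r → map (λ j → (i , j)) (upTo r)) (applyUpTo g (length ν)) ν ≡ rowCells g ν
cells-rowCells g []      = refl
cells-rowCells g (r ∷ ν) = cong (_ ∷_) (cells-rowCells (g ∘ suc) ν)

rows-increasing : (g : ℕ → ℕ) (ν vs : List ℕ) (Z : List ((ℕ × ℕ) × ℕ)) →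
                  (∀ {p} → p ∈ zip (concat (rowCells g ν)) vs → p ∈ Z) → RowIncreasing Z →
                  length vs ≡ sum ν → All (Linked _<_) (rows ν vs)
rows-increasing g []      vs Z _   _   _ = []
rows-increasing g (r ∷ ν) vs Z sub inc e =
  linked-row (g 0) (λ j → j) (λ _ → refl) (take r vs) Z head⊆Z inc
  ∷ rows-increasing (g ∘ suc) ν (drop r vs) Z (λ p → sub (split (∈-++⁺ʳ _ p))) inc (length-drop-row r ν vs e)
  where
  first rest : List (ℕ × ℕ)
  first = map (g 0 ,_) (upTo r)
  rest = concat (rowCells (g ∘ suc) ν)
  length-first : length first ≡ r
  length-first = trans (length-map _ (upTo r)) (length-applyUpTo _ r)
  split : ∀ {p} → p ∈ zip first (take r vs) ++ zip rest (drop r vs) →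
          p ∈ zip (concat (rowCells g (r ∷ ν))) vs
  split {p} = subst (p ∈_) (sym (trans (zip-++ first _ vs) (cong (λ k → zip first (take k vs) ++ zip rest (drop k vs)) length-first)))
  head⊆Z : ∀ {p} → p ∈ zip (applyUpTo (g 0 ,_) (length (take r vs))) (take r vs) → p ∈ Z
  head⊆Z {p} q rewrite length-take-row r ν vs e =
    sub (split (∈-++⁺ˡ (subst (λ cs → p ∈ zip cs (take r vs)) (sym (map-applyUpTo _ (g 0 ,_) r)) q)))

unique-++⁻ : {A : Set} {xs ys : List A} → Unique (xs ++ ys) → Unique xs × Unique ys × Disjoint xs ys
unique-++⁻ {xs = []}     u = [] , u , λ ()
unique-++⁻ {xs = x ∷ xs} {ys} (x∉ ∷ u) with unique-++⁻ {xs = xs} {ys} u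
... | uxs , uys , disjoint = All.tabulate (λ y∈ → All.lookup x∉ (∈-++⁺ˡ y∈)) ∷ uxs , uys , disjoint′
  where
  disjoint′ : Disjoint (x ∷ xs) ys
  disjoint′ (here refl , v∈ys) = All.lookup x∉ (∈-++⁺ʳ xs v∈ys) refl
  disjoint′ (there v∈xs , v∈ys) = disjoint (v∈xs , v∈ys)

unique-nth : {A : Set} (cs : List (List A)) → Unique (concat cs) → ∀ m → Unique (nth [] cs m)
unique-nth []       _ _       = []
unique-nth (c ∷ cs) u zero    = proj₁ (unique-++⁻ {xs = c} u)
unique-nth (c ∷ cs) u (suc m) = unique-nth cs (proj₁ (proj₂ (unique-++⁻ {xs = c} u))) m

∈-nth⇒∈-concat : {A : Set} (cs : List (List A)) → ∀ m {v} → v ∈ nth [] cs m → v ∈ concat cs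
∈-nth⇒∈-concat (c ∷ cs) zero    v∈ = ∈-++⁺ˡ v∈
∈-nth⇒∈-concat (c ∷ cs) (suc m) v∈ = ∈-++⁺ʳ c (∈-nth⇒∈-concat cs m v∈)

rowOf : List (List ℕ) → ℕ → ℕ
rowOf []       v = 0
rowOf (c ∷ cs) v with v ∈? c
... | yes _ = 0
... | no  _ = suc (rowOf cs v)

rowOf-∈ : (cs : List (List ℕ)) (v : ℕ) → rowOf cs v < length cs → v ∈ nth [] cs (rowOf cs v)
rowOf-∈ (c ∷ cs) v bound with v ∈? c
... | yes v∈c = v∈c
... | no  _   = rowOf-∈ cs v (≤-pred bound)

rowOf-< : (cs : List (List ℕ)) (v : ℕ) → v ∈ concat cs → rowOf cs v < length cs
rowOf-< (c ∷ cs) v v∈ with v ∈? c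
... | yes _   = z<s
... | no  v∉c with ∈-++⁻ c v∈
...   | inj₁ v∈c  = ⊥-elim (v∉c v∈c)
...   | inj₂ v∈cs = s<s (rowOf-< cs v v∈cs)

rowOf-unique : (cs : List (List ℕ)) → Unique (concat cs) → (v m : ℕ) → v ∈ nth [] cs m → rowOf cs v ≡ m
rowOf-unique (c ∷ cs) u v m v∈ with v ∈? c | m
... | yes _   | zero  = refl
... | yes v∈c | suc k = ⊥-elim (proj₂ (proj₂ (unique-++⁻ {xs = c} u)) (v∈c , ∈-nth⇒∈-concat cs k v∈))
... | no  v∉c | zero  = ⊥-elim (v∉c v∈)
... | no  _   | suc k = cong suc (rowOf-unique cs (proj₁ (proj₂ (unique-++⁻ {xs = c} u))) v k v∈)

-- the indicator of membership; on x ∷ c it is (v ≡ᵇ x) ∨ (v ∈ᵇ c) by computation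
_∈ᵇ_ : ℕ → List ℕ → Bool
v ∈ᵇ c = does (v ∈? c)

∈ᵇ⇒∈ : ∀ {v c} → T (v ∈ᵇ c) → v ∈ c
∈ᵇ⇒∈ {v} {c} h with v ∈? c
... | yes v∈c = v∈c
... | no  _   = ⊥-elim h

∈ᵇ-∷ : (v x : ℕ) (c : List ℕ) → x ∉ c → b2n ((v ≡ᵇ x) ∨ (v ∈ᵇ c)) ≡ δ v x + b2n (v ∈ᵇ c)
∈ᵇ-∷ v x c x∉c with v ≡ᵇ x in v≡ᵇx
... | false = refl
... | true with ≡ᵇ⇒≡ v x (Equivalence.from T-≡ v≡ᵇx)
...   | refl rewrite dec-false (v ∈? c) x∉c = refl

∑<-∈ᵇ : (N : ℕ) (c : List ℕ) → Unique c → All (_∈ map suc (upTo N)) c → ∑< N (λ t → b2n (suc t ∈ᵇ c)) ≡ length c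
∑<-∈ᵇ N []      _          _             = ∑<-zero N
∑<-∈ᵇ N (x ∷ c) (x∉c ∷ u) (x∈range ∷ c∈range) = begin
  ∑< N (λ t → b2n (suc t ∈ᵇ (x ∷ c)))                     ≡⟨ ∑<-cong N (λ t _ → ∈ᵇ-∷ (suc t) x c x∉c′) ⟩
  ∑< N (λ t → δ (suc t) x + b2n (suc t ∈ᵇ c))            ≡⟨ ∑<-+ N _ _ ⟩
  ∑< N (λ t → δ (suc t) x) + ∑< N (λ t → b2n (suc t ∈ᵇ c)) ≡⟨ cong₂ _+_ hits-x (∑<-∈ᵇ N c u c∈range) ⟩
  suc (length c)                                           ∎
  where
  open ≡-Reasoning
  x∉c′ : x ∉ c
  x∉c′ x∈c = All.lookup x∉c x∈c refl
  hits-x : ∑< N (λ t → δ (suc t) x) ≡ 1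
  hits-x with ∈-map⁻ suc x∈range
  ... | t , t∈ , refl = ∑<-δ N t (∈-upTo⁻ t∈)

b2n≤1 : ∀ c → b2n c ≤ 1
b2n≤1 true  = ≤-refl
b2n≤1 false = z≤n

b2n≡1 : ∀ {c} → b2n c ≡ 1 → T c
b2n≡1 {true} _ = _

head-< : ∀ {x xs} → Linked _<_ (x ∷ xs) → All (x <_) xs
head-< = AllPairs.head ∘ Linked⇒AllPairs <-trans

increasing-ext : {xs ys : List ℕ} → Linked _<_ xs → Linked _<_ ys →
                 (∀ {v} → v ∈ xs → v ∈ ys) → (∀ {v} → v ∈ ys → v ∈ xs) → xs ≡ ys
increasing-ext {[]}     {[]}     _  _  _  _  = refl
increasing-ext {[]}     {y ∷ ys} _  _  _  ys⊆ with ys⊆ (here refl)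
... | ()
increasing-ext {x ∷ xs} {[]}     _  _  xs⊆ _ with xs⊆ (here refl)
... | ()
increasing-ext {x ∷ xs} {y ∷ ys} lx ly xs⊆ ys⊆ =
  cong₂ _∷_ x≡y (increasing-ext (Linked.tail lx) (Linked.tail ly) tail⊆ tail⊇)
  where
  x≡y : x ≡ y
  x≡y with xs⊆ (here refl) | ys⊆ (here refl)
  ... | here e   | _        = e
  ... | there _  | here e   = sym e
  ... | there y∈ | there x∈ = ⊥-elim (<-asym (All.lookup (head-< ly) y∈) (All.lookup (head-< lx) x∈))
  tail⊆ : ∀ {v} → v ∈ xs → v ∈ ys
  tail⊆ v∈ with xs⊆ (there v∈)
  ... | here refl = ⊥-elim (<-irrefl x≡y (All.lookup (head-< lx) v∈))
  ... | there q   = q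
  tail⊇ : ∀ {v} → v ∈ ys → v ∈ xs
  tail⊇ v∈ with ys⊆ (there v∈)
  ... | here refl = ⊥-elim (<-irrefl (sym x≡y) (All.lookup (head-< ly) v∈))
  ... | there q   = q

-- Standard Young tableaux and their row words

record IsSYT (ν vs : List ℕ) : Set where
  field
    length≡         : length vs ≡ sum ν
    in-range        : All (_∈ map suc (upTo (sum ν))) vs
    entries-unique  : Unique vs
    rows-increase   : RowIncreasing (zip (cells ν) vs)
open IsSYT

isSYT : ∀ {ν vs} → vs ∈ listsOf (map suc (upTo (sum ν))) (sum ν) →
        T (distinct vs ∧ increasing (zip (cells ν) vs)) → IsSYT ν vs
isSYT {ν} {vs} vs∈ h with ∈-listsOf⁻ _ (sum ν) vs∈ | Equivalence.to T-∧ h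
... | len , range | dist , inc = record
  { length≡        = len
  ; in-range       = range
  ; entries-unique = distinct⇒unique vs dist
  ; rows-increase  = increasing⇒row-increasing _ inc
  }

rowWord : List ℕ → List ℕ → ℕ → ℕ
rowWord ν vs t = rowOf (rows ν vs) (suc t)

module _ {ν vs : List ℕ} (syt : IsSYT ν vs) where

  concat-rows-unique : Unique (concat (rows ν vs))
  concat-rows-unique = subst Unique (sym (concat-rows ν vs (length≡ syt))) (entries-unique syt)

  row-in-range : ∀ m {v} → v ∈ nth [] (rows ν vs) m → v ∈ map suc (upTo (sum ν))
  row-in-range m v∈ = All.lookup (in-range syt) (subst (_ ∈_) (concat-rows ν vs (length≡ syt)) (∈-nth⇒∈-concat (rows ν vs) m v∈))

  rows-linked : ∀ m → m < length ν → Linked _<_ (nth [] (rows ν vs) m)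
  rows-linked m m<ℓ = All-nth [] (rows ν vs) all-rows m (subst (m <_) (sym (length-rows ν vs)) m<ℓ)
    where
    cells≡ : zip (cells ν) vs ≡ zip (concat (rowCells (λ i → i) ν)) vs
    cells≡ = cong (λ cs → zip (concat cs) vs) (cells-rowCells (λ i → i) ν)
    all-rows : All (Linked _<_) (rows ν vs)
    all-rows = rows-increasing (λ i → i) ν vs (zip (cells ν) vs) (subst (_ ∈_) (sym cells≡)) (rows-increase syt) (length≡ syt)

  -- n distinct entries from {1, …, n}: every value occurs.
  entries-exhaust : ∀ t → t < sum ν → suc t ∈ vs
  entries-exhaust t t<n = ∈ᵇ⇒∈ (b2n≡1 (∑<-saturated (sum ν) indicator (λ _ → b2n≤1 _) count≡ t t<n))
    where
    indicator : ℕ → ℕ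
    indicator t = b2n (suc t ∈ᵇ vs)
    count≡ : ∑< (sum ν) indicator ≡ sum ν
    count≡ = trans (∑<-∈ᵇ (sum ν) vs (entries-unique syt) (in-range syt)) (length≡ syt)

  rowWord-bounded : Bounded (rowWord ν vs) (sum ν) (length ν)
  rowWord-bounded t t<n = subst (rowWord ν vs t <_) (length-rows ν vs) (rowOf-< (rows ν vs) (suc t) t+1∈rows)
    where
    t+1∈rows : suc t ∈ concat (rows ν vs)
    t+1∈rows = subst (suc t ∈_) (sym (concat-rows ν vs (length≡ syt))) (entries-exhaust t t<n)

  rowWord-δ : ∀ m → m < length ν → ∀ t → δ m (rowWord ν vs t) ≡ b2n (suc t ∈ᵇ nth [] (rows ν vs) m)
  rowWord-δ m m<ℓ t with suc t ∈? nth [] (rows ν vs) m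
  ... | yes t+1∈row rewrite rowOf-unique (rows ν vs) concat-rows-unique (suc t) m t+1∈row = δ-refl m
  ... | no  t+1∉row with m ≡ᵇ rowWord ν vs t in m≡ᵇw
  ...   | false = refl
  ...   | true with ≡ᵇ⇒≡ m _ (Equivalence.from T-≡ m≡ᵇw)
  ...     | refl = ⊥-elim (t+1∉row (rowOf-∈ (rows ν vs) (suc t) (subst (m <_) (sym (length-rows ν vs)) m<ℓ)))

  -- Row m of the tableau contains ν_m entries, so w takes the value m exactly ν_m times.
  rowWord-fibre : ∀ m → m < length ν → ∑< (sum ν) (λ t → δ m (rowWord ν vs t)) ≡ nth 0 ν m
  rowWord-fibre m m<ℓ = begin
    ∑< (sum ν) (λ t → δ m (rowWord ν vs t))                    ≡⟨ ∑<-cong (sum ν) (λ t _ → rowWord-δ m m<ℓ t) ⟩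
    ∑< (sum ν) (λ t → b2n (suc t ∈ᵇ nth [] (rows ν vs) m))     ≡⟨ ∑<-∈ᵇ (sum ν) _ (unique-nth (rows ν vs) concat-rows-unique m)
                                                                                    (All.tabulate (row-in-range m)) ⟩
    length (nth [] (rows ν vs) m)                              ≡⟨ length-row ν vs (length≡ syt) m m<ℓ ⟩
    nth 0 ν m                                                  ∎
    where open ≡-Reasoning

row-⊆ : {ν vs vs′ : List ℕ} → IsSYT ν vs → IsSYT ν vs′ → (∀ t → t < sum ν → rowWord ν vs t ≡ rowWord ν vs′ t) →
        ∀ m → m < length ν → ∀ {v} → v ∈ nth [] (rows ν vs) m → v ∈ nth [] (rows ν vs′) m
row-⊆ {ν} {vs} {vs′} syt syt′ same m m<ℓ v∈ with ∈-map⁻ suc (row-in-range syt m v∈)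
... | t , t∈ , refl = subst (λ k → suc t ∈ nth [] (rows ν vs′) k) w′t≡m (rowOf-∈ (rows ν vs′) (suc t) bound)
  where
  w′t≡m : rowWord ν vs′ t ≡ m
  w′t≡m = trans (sym (same t (∈-upTo⁻ t∈))) (rowOf-unique (rows ν vs) (concat-rows-unique syt) (suc t) m v∈)
  bound : rowWord ν vs′ t < length (rows ν vs′)
  bound = subst₂ _<_ (sym w′t≡m) (sym (length-rows ν vs′)) m<ℓ

-- A tableau is determined by its row word, because its rows increase.
rowWord-injective : {ν vs vs′ : List ℕ} → IsSYT ν vs → IsSYT ν vs′ →
                    (∀ t → t < sum ν → rowWord ν vs t ≡ rowWord ν vs′ t) → vs ≡ vs′
rowWord-injective {ν} {vs} {vs′} syt syt′ same = begin
  vs                   ≡⟨ concat-rows ν vs (length≡ syt) ⟨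
  concat (rows ν vs)   ≡⟨ cong concat (nth-ext [] (rows ν vs) (rows ν vs′) (trans (length-rows ν vs) (sym (length-rows ν vs′))) same-row) ⟩
  concat (rows ν vs′)  ≡⟨ concat-rows ν vs′ (length≡ syt′) ⟩
  vs′                  ∎
  where
  open ≡-Reasoning
  same-row : ∀ m → m < length (rows ν vs) → nth [] (rows ν vs) m ≡ nth [] (rows ν vs′) m
  same-row m m<ℓ′ = increasing-ext (rows-linked syt m m<ℓ) (rows-linked syt′ m m<ℓ)
                                   (row-⊆ syt syt′ same m m<ℓ) (row-⊆ syt′ syt (λ t t<n → sym (same t t<n)) m m<ℓ)
    where
    m<ℓ : m < length ν
    m<ℓ = subst (m <_) (length-rows ν vs) m<ℓ′

-- The encoding of tableaux as arrays

tableauArray : List ℕ → List ℕ → List ℕ → List (List (List Bool))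
tableauArray λs ν vs = wordArray (length ν) (length (conj λs)) λs (rowWord ν vs)

tableauArray-margins : ∀ {λs ν vs} → IsSYT ν vs → sum λs ≡ sum ν →
  let x = tableauArray λs ν vs in
  T (eqL (margin1 x) λs ∧ eqL (margin2 (length (conj λs)) x) (conj λs) ∧ eqL (margin3 (length ν) x) ν)
tableauArray-margins {λs} {ν} {vs} syt |λ|≡|ν| = margins-test
  (margin1-wordArray L b λs w (parts≤length-conj λs) bounded)
  (margin2-conj L λs w bounded)
  (begin
    margin3 L (wordArray L b λs w)                      ≡⟨ margin3-wordArray L b λs w (parts≤length-conj λs) ⟩
    applyUpTo (λ m → ∑< (sum λs) (λ t → δ m (w t))) L   ≡⟨ cong (λ k → applyUpTo (λ m → ∑< k (λ t → δ m (w t))) L) |λ|≡|ν| ⟩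
    applyUpTo (λ m → ∑< (sum ν) (λ t → δ m (w t))) L    ≡⟨ applyUpTo-nth ν _ (rowWord-fibre syt) ⟩
    ν                                                   ∎)
  where
  open ≡-Reasoning
  L b : ℕ
  L = length ν
  b = length (conj λs)
  w : ℕ → ℕ
  w = rowWord ν vs
  bounded : Bounded w (sum λs) L
  bounded = subst (λ k → Bounded w k L) (sym |λ|≡|ν|) (rowWord-bounded syt)

-- Distinct tableaux give distinct arrays: the fibre of cell t recovers w t.
tableauArray-injective : ∀ {λs ν vs vs′} → IsSYT ν vs → IsSYT ν vs′ → sum λs ≡ sum ν →
                         tableauArray λs ν vs ≡ tableauArray λs ν vs′ → vs ≡ vs′
tableauArray-injective {λs} {ν} {vs} {vs′} syt syt′ |λ|≡|ν| same-array = rowWord-injective syt syt′ same-word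
  where
  L b : ℕ
  L = length ν
  b = length (conj λs)
  same-word : ∀ t → t < sum ν → rowWord ν vs t ≡ rowWord ν vs′ t
  same-word t t<n = onehot-injective L _ _ (rowWord-bounded syt t t<n) (begin
    onehot L (rowWord ν vs t)               ≡⟨ cellFibre-wordArray L b λs (rowWord ν vs) (parts≤length-conj λs) t t<|λ| ⟨
    cellFibre (tableauArray λs ν vs) λs t   ≡⟨ cong (λ x → cellFibre x λs t) same-array ⟩
    cellFibre (tableauArray λs ν vs′) λs t  ≡⟨ cellFibre-wordArray L b λs (rowWord ν vs′) (parts≤length-conj λs) t t<|λ| ⟩
    onehot L (rowWord ν vs′ t)              ∎)
    where
    open ≡-Reasoning
    t<|λ| : t < sum λs
    t<|λ| = subst (t <_) (sym |λ|≡|ν|) t<n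

proposition8p5 : (n : ℕ) (λ′ ν : List ℕ) → IsPartition n λ′ → IsPartition n ν →
                   fSYT ν ≤ B λ′ (conj λ′) ν
proposition8p5 n λs ν (_ , _ , |λ|≡n) (_ , _ , |ν|≡n) =
  count-≤-by-injection _ _ _ _ (tableauArray λs ν) fillings-unique
    (λ vs∈ h → wordArray∈ _ _ λs _ , tableauArray-margins {λs} (isSYT {ν} vs∈ h) |λ|≡|ν|)
    (λ vs∈ vs′∈ h h′ → tableauArray-injective {λs} (isSYT {ν} vs∈ h) (isSYT {ν} vs′∈ h′) |λ|≡|ν|)
  where
  |λ|≡|ν| : sum λs ≡ sum ν
  |λ|≡|ν| = trans |λ|≡n (sym |ν|≡n)
  fillings-unique : Unique (listsOf (map suc (upTo (sum ν))) (sum ν))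
  fillings-unique = listsOf-unique _ (sum ν) (UniqueP.map⁺ suc-injective (UniqueP.upTo⁺ (sum ν)))
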